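{- Let $n\geq 3$. There exists a signature $E_-\subseteq E(P_{n,1})$ such that the frustration index of the signed graph $(P_{n,1},E_-)$ equals $\lfloor n/2\rfloor+1$.
   Context: For positive integers $n,k$ with $2\le 2k<n$, the generalised Petersen graph $P_{n,k}$ has vertex set $\{u_i,v_i: i\in\{0,\dots,n-1\}\}$ and edge set $\{u_iu_{i+1}, v_iv_{i+k}, u_iv_i : i\in\{0,\dots,n-1\}\}$, indices modulo $n$. A signed graph $(G,E_-)$ is a simple graph $G$ with a set $E_-\subseteq E(G)$ of negative edges (the signature); other edges are positive. A cycle is positive if the product of its edge signs is positive; a signed graph is balanced if every cycle is positive. The frustration index of $(G,E_-)$ is the minimum number of edges whose deletion leaves a balanced signed graph. -}

module Defs where

open import Data.Nat using (ℕ; zero; suc; _+_; _≤_; _%_)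
open import Data.Nat.DivMod using (_mod_)
open import Data.Fin using (Fin; toℕ)
open import Data.Bool using (Bool; true; false; if_then_else_)
open import Data.List using (List; []; _∷_; _++_; map; allFin; concatMap)
open import Data.Nat.ListAction using (sum)
open import Data.Product using (_×_; _,_; Σ)
open import Data.Sum using (_⊎_)
open import Function.Definitions using (Injective)
open import Relation.Binary.PropositionalEquality using (_≡_)

sucMod : ∀ {m} → Fin m → Fin m
sucMod {suc m} i = (suc (toℕ i)) mod (suc m)

data Vtx (n : ℕ) : Set where
  u : Fin n → Vtx n
  v : Fin n → Vtx n

-- Edges of the prism P_{n,1} (for n ≥ 3 these are 3n distinct edges):
--   rimU i = u_i u_{i+1},  rimV i = v_i v_{i+1},  spoke i = u_i v_i
data Edge (n : ℕ) : Set where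
  rimU  : Fin n → Edge n
  rimV  : Fin n → Edge n
  spoke : Fin n → Edge n

ends : ∀ {n} → Edge n → Vtx n × Vtx n
ends (rimU i)  = u i , u (sucMod i)
ends (rimV i)  = v i , v (sucMod i)
ends (spoke i) = u i , v i

Joins : ∀ {n} → Edge n → Vtx n → Vtx n → Set
Joins e x y = (ends e ≡ (x , y)) ⊎ (ends e ≡ (y , x))

allEdges : ∀ n → List (Edge n)
allEdges n = concatMap (λ i → rimU i ∷ rimV i ∷ spoke i ∷ []) (allFin n)

EdgeSet : ℕ → Set
EdgeSet n = Edge n → Bool

indicator : Bool → ℕ
indicator b = if b then 1 else 0

size : ∀ {n} → EdgeSet n → ℕ
size {n} S = sum (map (λ e → indicator (S e)) (allEdges n))

record Cycle {n : ℕ} (keep : EdgeSet n) : Set where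
  field
    len    : ℕ
    len≥3  : 3 ≤ len
    vs     : Fin len → Vtx n
    vs-inj : Injective _≡_ _≡_ vs
    es     : Fin len → Edge n
    es-in  : ∀ i → keep (es i) ≡ true
    es-joins : ∀ i → Joins (es i) (vs i) (vs (sucMod i))
open Cycle public

negCount : ∀ {n} {keep : EdgeSet n} → EdgeSet n → Cycle keep → ℕ
negCount σ C = sum (map (λ i → indicator (σ (es C i))) (allFin (len C)))

-- a cycle is positive iff the product of its edge signs is +, i.e. #negative edges even
PositiveCycle : ∀ {n} {keep : EdgeSet n} → EdgeSet n → Cycle keep → Set
PositiveCycle σ C = negCount σ C % 2 ≡ 0

Balanced : ∀ {n} → (keep σ : EdgeSet n) → Set
Balanced keep σ = (C : Cycle keep) → PositiveCycle σ C

complement : ∀ {n} → EdgeSet n → EdgeSet n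
complement D e = if D e then false else true

BalancingSet : ∀ {n} → (σ D : EdgeSet n) → Set
BalancingSet σ D = Balanced (complement D) σ

FrustrationIndex : ∀ {n} → EdgeSet n → ℕ → Set
FrustrationIndex {n} σ k =
  Σ (EdgeSet n) (λ D → BalancingSet σ D × size D ≡ k)
  × ((D : EdgeSet n) → BalancingSet σ D → k ≤ size D)

module Submission where

-- Write the prism's edges as outer rim edges u_i u_{i+1}, inner rim edges
-- v_i v_{i+1} and spokes u_i v_i, and let Q_i be the 4-cycle
-- u_i u_{i+1} v_{i+1} v_i.  Take the signature σ₀ in which u_i u_{i+1} is
-- negative for i ≠ 0 and only v_0 v_1 is negative among the inner rim edges.
--
-- If all n squares Q_i and the inner rim are
-- negative, a balancing set D meets every Q_i and the inner rim.  Every rim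
-- edge lies on one square and every spoke on two, so n ≤ #U + #V + 2·#S for
-- the numbers #U, #V, #S of outer rim, inner rim and spoke edges in D; with
-- #V ≥ 1 this gives n < 2·|D|, i.e. ⌊n/2⌋ + 1 ≤ |D|.
--
-- A signed graph with a potential f : V → Bool such that every
-- edge xy has sign f(x) xor f(y) is balanced, since the signs telescope around
-- any cycle.  With f(u_k) = "k is a positive even number" and f(v_k) = false,
-- the edges violating this are v_0 v_1, the spokes u_k v_k for positive even k,
-- and, when n is even, u_{n-1} u_0: exactly ⌊n/2⌋ + 1 edges.

open import Defs
open import Data.Nat using (ℕ; _≤_; _/_; _+_)
open import Data.Product using (Σ)
open import Data.Nat using (zero; suc; _*_; _<_; _%_; z≤n; s≤s)
open import Data.Nat.Properties
  using (+-0-commutativeMonoid; +-*-semiring; +-comm; +-identityʳ; +-mono-≤; m≤n+m; m+n≡0⇒m≡0;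
         m+n≡0⇒n≡0; n≢0⇒n>0; 1+n≢n; ≤-trans; module ≤-Reasoning; m≤n⇒m<n∨m≡n)
open import Data.Nat.DivMod using (m<n⇒m%n≡m; n%n≡0; [m+kn]%n≡m%n; m/n≡1+[m∸n]/n; m<n*o⇒m/o<n)
open import Data.Nat.ListAction using () renaming (sum to sumList)
open import Data.Nat.ListAction.Properties using (sum-++)
open import Data.Nat.Solver using (module +-*-Solver)
open import Data.Fin using (Fin; toℕ; inject₁; fromℕ) renaming (zero to fz; suc to fs)
open import Data.Fin.Properties using (toℕ-fromℕ<; toℕ-injective; toℕ-inject₁; toℕ-fromℕ; toℕ<n; toℕ≤pred[n])
open import Data.Bool using (Bool; true; false; not; _∧_; _xor_; if_then_else_)
open import Data.Bool.Properties using (xor-comm; xor-identityʳ; not-involutive; ∧-identityʳ; ∧-zeroʳ)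
open import Data.List using (List; []; _∷_; _++_; map; tabulate; concatMap)
open import Data.List.Properties using (map-++)
open import Data.Product using (_,_; _×_; proj₁; proj₂)
open import Data.Sum using (inj₁; inj₂; _⊎_)
open import Data.Empty using (⊥-elim)
open import Relation.Nullary using (¬_)
open import Relation.Binary.PropositionalEquality
open import Algebra.Properties.CommutativeMonoid.Sum +-0-commutativeMonoid
  using (sum-syntax; ∑-distrib-+; ∑-comm; sum-cong-≗; sum-init-last; sum-replicate-zero)
open import Algebra.Properties.Semiring.Sum +-*-semiring using (*-distribʳ-sum)

open +-*-Solver using (solve; _:+_; _:*_; _:=_; con)

ind : Bool → ℕ
ind = indicator

odd≢even : ∀ k → k % 2 ≡ 1 → ¬ (k % 2 ≡ 0)
odd≢even _ odd even with trans (sym odd) even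
... | ()

sum-list-tabulate : ∀ {A : Set} n (g : Fin n → A) (f : A → ℕ) →
                    sumList (map f (tabulate g)) ≡ ∑[ i < n ] f (g i)
sum-list-tabulate zero    g f = refl
sum-list-tabulate (suc n) g f = cong (f (g fz) +_) (sum-list-tabulate n (λ i → g (fs i)) f)

sum-list-concat : ∀ {A B : Set} n (g : Fin n → A) (ℓ : A → List B) (f : B → ℕ) →
                  sumList (map f (concatMap ℓ (tabulate g))) ≡ ∑[ i < n ] sumList (map f (ℓ (g i)))
sum-list-concat zero    g ℓ f = refl
sum-list-concat (suc n) g ℓ f = begin
  sumList (map f (ℓ (g fz) ++ rest))                ≡⟨ cong sumList (map-++ f (ℓ (g fz)) rest) ⟩
  sumList (map f (ℓ (g fz)) ++ map f rest)          ≡⟨ sum-++ (map f (ℓ (g fz))) (map f rest) ⟩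
  sumList (map f (ℓ (g fz))) + sumList (map f rest) ≡⟨ cong (_ +_) (sum-list-concat n (λ i → g (fs i)) ℓ f) ⟩
  ∑[ i < suc n ] sumList (map f (ℓ (g i)))          ∎
  where
  open ≡-Reasoning
  rest = concatMap ℓ (tabulate (λ i → g (fs i)))

sum-snoc : ∀ m (g : ℕ → ℕ) → ∑[ i < suc m ] g (toℕ i) ≡ ∑[ i < m ] g (toℕ i) + g m
sum-snoc m g = trans (sum-init-last {m} (λ i → g (toℕ i)))
  (cong₂ _+_ (sum-cong-≗ {m} (λ i → cong g (toℕ-inject₁ i))) (cong g (toℕ-fromℕ m)))

sum-lower-bound : ∀ n (f : Fin n → ℕ) → (∀ i → 1 ≤ f i) → n ≤ ∑[ i < n ] f i
sum-lower-bound zero    f one = z≤n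
sum-lower-bound (suc n) f one = +-mono-≤ (one fz) (sum-lower-bound n (λ i → f (fs i)) (λ i → one (fs i)))

sum-zero : ∀ n (f : Fin n → ℕ) → ∑[ i < n ] f i ≡ 0 → ∀ i → f i ≡ 0
sum-zero (suc n) f z fz     = m+n≡0⇒m≡0 (f fz) z
sum-zero (suc n) f z (fs i) = sum-zero n (λ i → f (fs i)) (m+n≡0⇒n≡0 (f fz) z) i

sucMod-cases : ∀ {m} (i : Fin (suc m)) →
               (toℕ (sucMod i) ≡ suc (toℕ i)) ⊎ (toℕ i ≡ m × toℕ (sucMod i) ≡ 0)
sucMod-cases {m} i with m≤n⇒m<n∨m≡n (toℕ≤pred[n] i)
... | inj₁ i<m = inj₁ (trans (toℕ-fromℕ< _) (m<n⇒m%n≡m (s≤s i<m)))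
... | inj₂ i≡m = inj₂ (i≡m , trans (toℕ-fromℕ< _) (trans (cong (λ x → suc x % suc m) i≡m) (n%n≡0 (suc m))))

sucMod-inject₁ : ∀ {m} (i : Fin m) → sucMod (inject₁ i) ≡ fs i
sucMod-inject₁ {m} i = toℕ-injective (trans (toℕ-fromℕ< _)
  (trans (cong (λ x → suc x % suc m) (toℕ-inject₁ i)) (m<n⇒m%n≡m (s≤s (toℕ<n i)))))

sucMod-last : ∀ m → sucMod (fromℕ m) ≡ fz
sucMod-last m = toℕ-injective (trans (toℕ-fromℕ< _)
  (trans (cong (λ x → suc x % suc m) (toℕ-fromℕ m)) (n%n≡0 (suc m))))

sucMod-moves : ∀ {m} (i : Fin (suc (suc m))) → i ≢ sucMod i
sucMod-moves i i≡si with sucMod-cases i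
... | inj₁ p       = 1+n≢n (sym (trans (cong toℕ i≡si) p))
... | inj₂ (p , q) with trans (sym p) (trans (cong toℕ i≡si) q)
... | ()

sum-rotate : ∀ m (g : Fin (suc m) → ℕ) → ∑[ i < suc m ] g (sucMod i) ≡ ∑[ i < suc m ] g i
sum-rotate m g = trans (sum-init-last {m} (λ i → g (sucMod i)))
  (trans (cong₂ _+_ (sum-cong-≗ {m} (λ i → cong g (sucMod-inject₁ i))) (cong g (sucMod-last m)))
         (+-comm _ (g fz)))

count : ∀ {n} → EdgeSet n → (Fin n → Edge n) → ℕ
count {n} X f = ∑[ i < n ] ind (X (f i))

size-count : ∀ {n} (X : EdgeSet n) → size X ≡ count X rimU + (count X rimV + (count X spoke + 0))
size-count {n} X =
  trans (sum-list-concat n (λ i → i) (λ i → rimU i ∷ rimV i ∷ spoke i ∷ []) (λ e → ind (X e)))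
        (∑-comm (λ i k → ind (X (star i k))))
  where
  star : Fin n → Fin 3 → Edge n
  star i fz           = rimU i
  star i (fs fz)      = rimV i
  star i (fs (fs fz)) = spoke i

negCount-sum : ∀ {n} {keep : EdgeSet n} (σ : EdgeSet n) (C : Cycle keep) →
               negCount σ C ≡ ∑[ k < len C ] ind (σ (es C k))
negCount-sum σ C = sum-list-tabulate (len C) (λ k → k) (λ k → ind (σ (es C k)))

avoided : ∀ {n L} (D : EdgeSet n) (e : Fin L → Edge n) →
          ∑[ k < L ] ind (D (e k)) ≡ 0 → ∀ k → complement D (e k) ≡ true
avoided {L = L} D e z k = survives (D (e k)) (sum-zero L (λ k → ind (D (e k))) z k)
  where
  survives : ∀ b → ind b ≡ 0 → (if b then false else true) ≡ true
  survives false _ = refl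

-- Balance from a potential

-- Pointwise form of a xor b ≡ a + b (mod 2).
ind-xor : ∀ a b → ind (a xor b) + ind (a ∧ b) * 2 ≡ ind a + ind b
ind-xor true  true  = refl
ind-xor true  false = refl
ind-xor false true  = refl
ind-xor false false = refl

-- Around a closed walk, the number of sign changes of a Boolean labelling is even:
-- Σ (x_k xor x_{k+1}) + 2 Σ (x_k ∧ x_{k+1}) = Σ x_k + Σ x_{k+1} = 2 Σ x_k.
changes-even : ∀ L → 1 ≤ L → (x : Fin L → Bool) → (∑[ k < L ] ind (x k xor x (sucMod k))) % 2 ≡ 0
changes-even (suc m) _ x = begin
  s % 2              ≡⟨ [m+kn]%n≡m%n s A 2 ⟨
  (s + A * 2) % 2    ≡⟨ cong (_% 2) (cong (s +_) (*-distribʳ-sum 2 (λ k → ind (x k ∧ x (sucMod k))))) ⟩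
  (s + ∑[ k < suc m ] (ind (x k ∧ x (sucMod k)) * 2)) % 2
    ≡⟨ cong (_% 2) (∑-distrib-+ (λ k → ind (x k xor x (sucMod k))) (λ k → ind (x k ∧ x (sucMod k)) * 2)) ⟨
  (∑[ k < suc m ] (ind (x k xor x (sucMod k)) + ind (x k ∧ x (sucMod k)) * 2)) % 2
    ≡⟨ cong (_% 2) (sum-cong-≗ (λ k → ind-xor (x k) (x (sucMod k)))) ⟩
  (∑[ k < suc m ] (ind (x k) + ind (x (sucMod k)))) % 2
    ≡⟨ cong (_% 2) (∑-distrib-+ (λ k → ind (x k)) (λ k → ind (x (sucMod k)))) ⟩
  (X + ∑[ k < suc m ] ind (x (sucMod k))) % 2 ≡⟨ cong (λ y → (X + y) % 2) (sum-rotate m (λ k → ind (x k))) ⟩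
  (X + X) % 2        ≡⟨ cong (_% 2) (solve 1 (λ a → a :+ a := con 0 :+ a :* con 2) refl X) ⟩
  (0 + X * 2) % 2    ≡⟨ [m+kn]%n≡m%n 0 X 2 ⟩
  0                  ∎
  where
  open ≡-Reasoning
  s = ∑[ k < suc m ] ind (x k xor x (sucMod k))
  A = ∑[ k < suc m ] ind (x k ∧ x (sucMod k))
  X = ∑[ k < suc m ] ind (x k)

potential⇒balanced : ∀ {n} (keep σ : EdgeSet n) (f : Vtx n → Bool) →
  (∀ e → keep e ≡ true → σ e ≡ f (proj₁ (ends e)) xor f (proj₂ (ends e))) → Balanced keep σ
potential⇒balanced keep σ f diff C =
  trans (cong (_% 2) (trans (negCount-sum σ C) (sum-cong-≗ change)))
        (changes-even (len C) (≤-trans (s≤s z≤n) (len≥3 C)) (λ k → f (vs C k)))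
  where
  change : ∀ k → ind (σ (es C k)) ≡ ind (f (vs C k) xor f (vs C (sucMod k)))
  change k with es-joins C k
  ... | inj₁ p = cong ind (trans (diff (es C k) (es-in C k)) (cong (λ q → f (proj₁ q) xor f (proj₂ q)) p))
  ... | inj₂ p = cong ind (trans (diff (es C k) (es-in C k))
                   (trans (cong (λ q → f (proj₁ q) xor f (proj₂ q)) p) (xor-comm (f (vs C (sucMod k))) (f (vs C k)))))

-- Two families of cycles in the prism

squareVertex : ∀ {n} → Fin n → Fin 4 → Vtx n
squareVertex i fz                = u i
squareVertex i (fs fz)           = u (sucMod i)
squareVertex i (fs (fs fz))      = v (sucMod i)
squareVertex i (fs (fs (fs fz))) = v i

squareEdge : ∀ {n} → Fin n → Fin 4 → Edge n
squareEdge i fz                = rimU i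
squareEdge i (fs fz)           = spoke (sucMod i)
squareEdge i (fs (fs fz))      = rimV i
squareEdge i (fs (fs (fs fz))) = spoke i

u-injective : ∀ {n} {a b : Fin n} → u a ≡ u b → a ≡ b
u-injective refl = refl

v-injective : ∀ {n} {a b : Fin n} → v a ≡ v b → a ≡ b
v-injective refl = refl

square : ∀ {n} (keep : EdgeSet n) (i : Fin n) → i ≢ sucMod i →
         (∀ k → keep (squareEdge i k) ≡ true) → Cycle keep
square keep i moves kept = record
  { len = 4 ; len≥3 = s≤s (s≤s (s≤s z≤n)) ; vs = squareVertex i ; vs-inj = distinct
  ; es = squareEdge i ; es-in = kept ; es-joins = joins }
  where
  distinct : ∀ {a b} → squareVertex i a ≡ squareVertex i b → a ≡ b
  distinct {fz}                {fz}                _ = refl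
  distinct {fs fz}             {fs fz}             _ = refl
  distinct {fs (fs fz)}        {fs (fs fz)}        _ = refl
  distinct {fs (fs (fs fz))}   {fs (fs (fs fz))}   _ = refl
  distinct {fz}                {fs fz}             p = ⊥-elim (moves (u-injective p))
  distinct {fs fz}             {fz}                p = ⊥-elim (moves (sym (u-injective p)))
  distinct {fs (fs fz)}        {fs (fs (fs fz))}   p = ⊥-elim (moves (sym (v-injective p)))
  distinct {fs (fs (fs fz))}   {fs (fs fz)}        p = ⊥-elim (moves (v-injective p))
  distinct {fz}                {fs (fs fz)}        ()
  distinct {fz}                {fs (fs (fs fz))}   ()
  distinct {fs fz}             {fs (fs fz)}        ()
  distinct {fs fz}             {fs (fs (fs fz))}   ()
  distinct {fs (fs fz)}        {fz}                ()
  distinct {fs (fs fz)}        {fs fz}             ()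
  distinct {fs (fs (fs fz))}   {fz}                ()
  distinct {fs (fs (fs fz))}   {fs fz}             ()
  joins : ∀ k → Joins (squareEdge i k) (squareVertex i k) (squareVertex i (sucMod k))
  joins fz                = inj₁ refl
  joins (fs fz)           = inj₁ refl
  joins (fs (fs fz))      = inj₂ refl
  joins (fs (fs (fs fz))) = inj₂ refl

innerRim : ∀ {n} (keep : EdgeSet n) → 3 ≤ n → (∀ i → keep (rimV i) ≡ true) → Cycle keep
innerRim keep 3≤n kept = record
  { len = _ ; len≥3 = 3≤n ; vs = v ; vs-inj = v-injective
  ; es = rimV ; es-in = kept ; es-joins = λ _ → inj₁ refl }

-- The lower bound, for any signature making all squares and the inner rim negative

onSquare : ∀ {n} → EdgeSet n → Fin n → ℕ
onSquare X i = ∑[ k < 4 ] ind (X (squareEdge i k))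

-- Every rim edge lies on one square and every spoke on two.
sum-onSquare : ∀ m (X : EdgeSet (suc m)) →
  ∑[ i < suc m ] onSquare X i ≡ count X rimU + (count X spoke + (count X rimV + (count X spoke + 0)))
sum-onSquare m X =
  trans (∑-comm {suc m} {4} (λ i k → ind (X (squareEdge i k))))
        (cong (λ c → count X rimU + (c + (count X rimV + (count X spoke + 0))))
              (sum-rotate m (λ i → ind (X (spoke i)))))

square-hit : ∀ m (σ D : EdgeSet (suc (suc m))) → BalancingSet σ D →
             ∀ i → onSquare σ i % 2 ≡ 1 → 1 ≤ onSquare D i
square-hit m σ D balancing i negative = n≢0⇒n>0 {onSquare D i} λ missed →
  let Q = square (complement D) i (sucMod-moves i) (avoided D (squareEdge i) missed)
  in odd≢even (onSquare σ i) negative (trans (cong (_% 2) (sym (negCount-sum σ Q))) (balancing Q))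

inner-hit : ∀ {n} (σ D : EdgeSet n) → 3 ≤ n → BalancingSet σ D →
            count σ rimV % 2 ≡ 1 → 1 ≤ count D rimV
inner-hit σ D 3≤n balancing negative = n≢0⇒n>0 {count D rimV} λ missed →
  let R = innerRim (complement D) 3≤n (avoided D rimV missed)
  in odd≢even (count σ rimV) negative (trans (cong (_% 2) (sym (negCount-sum σ R))) (balancing R))

-- Double counting: n ≤ #U + 2·#S + #V and #V ≥ 1, hence n < 2·|D|.
frustration-lower-bound : ∀ {n} (σ : EdgeSet n) → 3 ≤ n →
  (∀ i → onSquare σ i % 2 ≡ 1) → count σ rimV % 2 ≡ 1 →
  (D : EdgeSet n) → BalancingSet σ D → n / 2 + 1 ≤ size D
frustration-lower-bound {suc zero} σ (s≤s ())
frustration-lower-bound {n@(suc (suc m))} σ 3≤n squares inner D balancing =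
  subst (_≤ size D) (+-comm 1 (n / 2)) (m<n*o⇒m/o<n {n} {size D} {2} n<2|D|)
  where
  U = count D rimU
  V = count D rimV
  S = count D spoke
  squareBound : n ≤ U + (S + (V + (S + 0)))
  squareBound = subst (n ≤_) (sum-onSquare (suc m) D)
    (sum-lower-bound n (onSquare D) (λ i → square-hit m σ D balancing i (squares i)))
  n<2|D| : n < size D * 2
  n<2|D| = begin-strict
    n                                  <⟨ +-mono-≤ (inner-hit σ D 3≤n balancing inner) squareBound ⟩
    V + (U + (S + (V + (S + 0))))      ≤⟨ m≤n+m _ U ⟩
    U + (V + (U + (S + (V + (S + 0))))) ≡⟨ solve 3 (λ U V S → U :+ (V :+ (U :+ (S :+ (V :+ (S :+ con 0)))))
                                                  := (U :+ (V :+ (S :+ con 0))) :* con 2) refl U V S ⟩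
    (U + (V + (S + 0))) * 2            ≡⟨ cong (_* 2) (size-count D) ⟨
    size D * 2                         ∎
    where open ≤-Reasoning

-- The signature σ₀, its potential and its balancing set D₀

even : ℕ → Bool
even zero    = true
even (suc k) = not (even k)

positiveEven : ℕ → Bool
positiveEven zero    = false
positiveEven (suc k) = even (suc k)

atZero : ∀ {n} → Fin n → Bool
atZero fz     = true
atZero (fs _) = false

σ₀ : ∀ {n} → EdgeSet n
σ₀ (rimU i)  = not (atZero i)
σ₀ (rimV i)  = atZero i
σ₀ (spoke i) = false

potential₀ : ∀ {n} → Vtx n → Bool
potential₀ (u i) = positiveEven (toℕ i)
potential₀ (v i) = false

-- The edges on which σ₀ disagrees with the differences of potential₀.
D₀ : ∀ {n} → EdgeSet n
D₀ {n} (rimU i) = even n ∧ atZero (sucMod i)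
D₀ (rimV i)     = atZero i
D₀ (spoke i)    = positiveEven (toℕ i)

-- Under σ₀ every square has exactly one negative edge, …
σ₀-squares : ∀ m (i : Fin (suc m)) → onSquare σ₀ i % 2 ≡ 1
σ₀-squares m fz     = refl
σ₀-squares m (fs i) = refl

count-atZero : ∀ m b → ∑[ i < suc m ] ind (b ∧ atZero i) ≡ ind b
count-atZero m b = begin
  ind (b ∧ true) + ∑[ i < m ] ind (b ∧ false) ≡⟨ cong₂ _+_ (cong ind (∧-identityʳ b))
                                                        (sum-cong-≗ {m} (λ _ → cong ind (∧-zeroʳ b))) ⟩
  ind b + ∑[ i < m ] 0                        ≡⟨ cong (ind b +_) (sum-replicate-zero m) ⟩
  ind b + 0                                   ≡⟨ +-identityʳ (ind b) ⟩
  ind b                                       ∎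
  where open ≡-Reasoning

σ₀-inner : ∀ m → count (σ₀ {suc m}) rimV % 2 ≡ 1
σ₀-inner m = cong (_% 2) (count-atZero m true)

-- Along a non-wrapping outer rim edge u_t u_{t+1} the potential changes
-- exactly when t ≠ 0, since consecutive positive numbers differ in parity.
potential-step : ∀ {n} (i : Fin n) → not (atZero i) ≡ positiveEven (toℕ i) xor positiveEven (suc (toℕ i))
potential-step fz     = refl
potential-step (fs j) = alternates (even (toℕ j))
  where
  alternates : ∀ b → true ≡ not b xor not (not b)
  alternates true  = refl
  alternates false = refl

-- If n is odd, the potential of the last index n - 1 is true.
wraps : ∀ b → not (not b) ≡ false → true ≡ not b xor false
wraps false _ = refl

absent : ∀ {n} (D : EdgeSet n) e → complement D e ≡ true → D e ≡ false
absent D e kept with D e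
... | false = refl

atZero-suc : ∀ {n k} (i : Fin n) → toℕ i ≡ suc k → atZero i ≡ false
atZero-suc (fs _) _ = refl

D₀-potential : ∀ m (e : Edge (suc (suc m))) → complement D₀ e ≡ true →
               σ₀ e ≡ potential₀ (proj₁ (ends e)) xor potential₀ (proj₂ (ends e))
D₀-potential m (spoke i) kept = sym (trans (xor-identityʳ _) (absent D₀ (spoke i) kept))
D₀-potential m (rimV i)  kept = absent D₀ (rimV i) kept
D₀-potential m (rimU i)  kept with sucMod-cases i
... | inj₁ step = trans (potential-step i) (cong (λ t → positiveEven (toℕ i) xor positiveEven t) (sym step))
... | inj₂ (last , wrap) = begin
  not (atZero i)                                    ≡⟨ cong not (atZero-suc i last) ⟩
  true                                              ≡⟨ wraps (even m) n-odd ⟩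
  positiveEven (suc m) xor positiveEven 0           ≡⟨ cong₂ (λ a b → positiveEven a xor positiveEven b) (sym last) (sym wrap) ⟩
  positiveEven (toℕ i) xor positiveEven (toℕ (sucMod i)) ∎
  where
  open ≡-Reasoning
  -- the wrap-around edge is kept only when n is odd
  n-odd : even (suc (suc m)) ≡ false
  n-odd = trans (sym (∧-identityʳ _))
    (subst (λ j → even (suc (suc m)) ∧ atZero j ≡ false) (toℕ-injective {i = sucMod i} {j = fz} wrap)
           (absent D₀ (rimU i) kept))

half-step : ∀ n → n / 2 + ind (even (suc n)) ≡ suc n / 2
half-step zero          = refl
half-step (suc zero)    = refl
half-step (suc (suc n)) = begin
  suc (suc n) / 2 + ind (even (suc (suc (suc n))))
    ≡⟨ cong₂ _+_ (m/n≡1+[m∸n]/n {suc (suc n)} {2} (s≤s (s≤s z≤n))) (cong ind (not-involutive (even (suc n)))) ⟩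
  suc (n / 2 + ind (even (suc n))) ≡⟨ cong suc (half-step n) ⟩
  suc (suc n / 2)                  ≡⟨ m/n≡1+[m∸n]/n {suc (suc (suc n))} {2} (s≤s (s≤s z≤n)) ⟨
  suc (suc (suc n)) / 2            ∎
  where open ≡-Reasoning

evens-count : ∀ m → ∑[ i < m ] ind (even (suc (toℕ i))) + ind (even (suc m)) ≡ suc m / 2
evens-count zero    = refl
evens-count (suc m) = begin
  ∑[ i < suc m ] g (toℕ i) + ind (even (suc (suc m)))      ≡⟨ cong (_+ ind (even (suc (suc m)))) (sum-snoc m g) ⟩
  ∑[ i < m ] g (toℕ i) + g m + ind (even (suc (suc m)))    ≡⟨ cong (_+ ind (even (suc (suc m)))) (evens-count m) ⟩
  suc m / 2 + ind (even (suc (suc m)))                    ≡⟨ half-step (suc m) ⟩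
  suc (suc m) / 2                                         ∎
  where
  open ≡-Reasoning
  g : ℕ → ℕ
  g k = ind (even (suc k))

-- |D₀| = [n even] + 1 + #{positive even k < n} = ⌊n/2⌋ + 1.
D₀-size : ∀ m → size (D₀ {suc m}) ≡ suc m / 2 + 1
D₀-size m = begin
  size (D₀ {n})                                 ≡⟨ size-count (D₀ {n}) ⟩
  count (D₀ {n}) rimU + (count (D₀ {n}) rimV + (E + 0)) ≡⟨ cong₂ (λ a b → a + (b + (E + 0))) rims (count-atZero m true) ⟩
  ind (even n) + (1 + (E + 0))                  ≡⟨ solve 2 (λ a e → a :+ (con 1 :+ (e :+ con 0)) := (e :+ a) :+ con 1)
                                                         refl (ind (even n)) E ⟩
  (E + ind (even n)) + 1                        ≡⟨ cong (_+ 1) (evens-count m) ⟩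
  n / 2 + 1                                     ∎
  where
  open ≡-Reasoning
  n = suc m
  E = ∑[ i < m ] ind (even (suc (toℕ i)))
  rims : count (D₀ {n}) rimU ≡ ind (even n)
  rims = trans (sum-rotate m (λ i → ind (even n ∧ atZero i))) (count-atZero m (even n))

lemma3p4 : (n : ℕ) → 3 ≤ n → Σ (EdgeSet n) (λ σ → FrustrationIndex σ (n / 2 + 1))
lemma3p4 (suc zero)    (s≤s ())
lemma3p4 (suc (suc m)) 3≤n =
  σ₀ , ((D₀ , balanced , D₀-size (suc m)) , optimal)
  where
  balanced : BalancingSet σ₀ D₀
  balanced = potential⇒balanced (complement D₀) σ₀ potential₀ (D₀-potential m)
  optimal : (D : EdgeSet (suc (suc m))) → BalancingSet σ₀ D → suc (suc m) / 2 + 1 ≤ size D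
  optimal = frustration-lower-bound σ₀ 3≤n (σ₀-squares (suc m)) (σ₀-inner (suc m))
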